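{- In the combinatorial Marker-Cutter game, for any game state $\gamma$ and any move of Marker, if restricted Cutter has a legal move in response, then the resulting game state $\gamma'$ satisfies $v(\gamma')=v(\gamma)+1$.
   Context: A set of boundary cycles is a pair $(D,\chi)$: $D$ a finite directed graph each of whose components is a directed cycle (loops allowed, no isolated vertices), $\chi:E(D)\to L$ an edge labelling; proper if each label is used on at most two edges. A game state is $\gamma=(D,\chi,g)$ with $(D,\chi)$ proper, $g\in\mathbb N_0$; its value $v(\gamma)$ is the number of distinct labels used. Game moves: at turn $k$ with state $(D_k,\chi_k,g_k)$, Marker chooses $v,w$ (not necessarily distinct) from $V(D_k)\sqcup\{v_\gamma,w_\gamma\}$ (dummy vertices; each chosen dummy vertex, without multiplicity, is added as a new vertex). Let $C,C'$ be the components containing $v,w$. Splitting a vertex $u$ replaces it by a source $u_1$ (incident to the out-edge) and a sink $u_2$ (incident to the in-edge). If $C=C'$: splitting turns $C$ into a directed path $P$ from $v_1$ to $w_2$ and a directed path $P'$ from $w_1$ to $v_2$ (trivial paths with $v_1=w_2$, $v_2=w_1$ if $v=w$ is dummy); new edges $f=\overrightarrow{w_2v_1}$, $f'=\overrightarrow{v_2w_1}$; $\hat C_1=P\cup\{f\}$, $\hat C_2=P'\cup\{f'\}$. Cutter chooses (a) $D_{k+1}=\bar D\cup\hat C_1\cup\hat C_2$, $g_{k+1}=g_k-1$ (only if $g_k\ge1$); (b) $D_{k+1}=\bar D\cup\hat C_1$, $g_{k+1}=\bar g$; (c) $D_{k+1}=\bar D\cup\hat C_2$, $g_{k+1}=\bar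 g$; with $\bar D$ a union of components of $D_k\setminus C$, $0\le\bar g\le g_k$. If $C\ne C'$: splitting turns $C$ into a path $P$ from $v_1$ to $v_2$ (trivial if $v$ dummy) and $C'$ into $P'$ from $w_1$ to $w_2$; the only move (d) is $D_{k+1}=(D_k\cup\hat C)\setminus(C\cup C')$ with $\hat C=P\cup P'\cup\{\overrightarrow{w_2v_1},\overrightarrow{v_2w_1}\}$, $g_{k+1}=g_k$. In all cases old labels are kept and the new edges receive one common new label not previously used. A contraction contracts one edge (deleting resulting isolated vertices). $(D',\chi',g')$ is a reduction of $(D,\chi,g)$ if $g'\le g$, $D'$ is obtained from $D$ by contractions and $\chi'=\chi$ on $E(D')$. Game states are equivalent if they are isomorphic as labelled digraphs up to a bijective relabelling and have equal counters. Restricted Cutter may never make a move producing a game state equivalent to a reduction of an earlier game state (including the current one), and in moves (a), (b), (c) must take $\bar D=D_k\setminus C$ and $\bar g=g_k$. -}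

module Defs where

open import Data.Nat using (ℕ; zero; suc; _+_; _∸_; _≤_; _%_)
open import Data.Nat.Properties using (_≟_)
open import Data.Nat.DivMod using (m%n<n)
open import Data.Fin as Fin using (Fin; toℕ; fromℕ<)
open import Data.List as List using (List; []; _∷_; _++_; length; lookup; filter; deduplicate; concatMap; take; drop; removeAt)
open import Data.List.NonEmpty as List⁺ using (List⁺; _∷_; head; tail; toList; _∷ʳ_; fromList)
open import Data.List.Membership.Propositional using (_∈_; _∉_)
open import Data.Maybe using (Maybe; just; nothing)
open import Data.Bool using (Bool; true; false; if_then_else_; _∨_)
open import Data.Product using (Σ; Σ-syntax; ∃; _×_; _,_)
open import Data.Sum using (_⊎_; inj₁; inj₂)
open import Data.Empty using (⊥)
open import Relation.Nullary using (¬_; yes; no)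
open import Relation.Nullary.Decidable using (⌊_⌋)
open import Relation.Binary.PropositionalEquality using (_≡_; _≢_; refl)
open import Relation.Binary.Construct.Closure.ReflexiveTransitive using (Star)
open import Function.Bundles using (_↔_; Inverse)

-- Labels are natural numbers (L = ℕ).
-- A directed cycle is given by the cyclic sequence of the labels of its
-- edges: the cycle  l₀ ∷ l₁ ∷ … ∷ l_{k-1}  has vertices u₀ … u_{k-1} and
-- edges e_i = u_i → u_{i+1 mod k} with label l_i  (k = 1 is a loop).
-- A set of boundary cycles (D, χ) is a finite list of such cycles
-- (every component is a directed cycle, no isolated vertices).

Cycle : Set
Cycle = List⁺ ℕ

Cycles : Set
Cycles = List Cycle

size : Cycle → ℕ
size C = suc (length (tail C))

lab : (C : Cycle) → Fin (size C) → ℕ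
lab C i = lookup (head C ∷ tail C) i

next : {k : ℕ} → Fin (suc k) → Fin (suc k)
next {k} i = fromℕ< (m%n<n (suc (toℕ i)) (suc k))

Vtx : Cycles → Set
Vtx D = Σ (Fin (length D)) (λ c → Fin (size (lookup D c)))

Edge : Cycles → Set
Edge D = Σ (Fin (length D)) (λ c → Fin (size (lookup D c)))

src : (D : Cycles) → Edge D → Vtx D
src D (c , i) = (c , i)

tgt : (D : Cycles) → Edge D → Vtx D
tgt D (c , i) = (c , next i)

χ : (D : Cycles) → Edge D → ℕ
χ D (c , i) = lab (lookup D c) i

labels : Cycles → List ℕ
labels D = concatMap toList D

Proper : Cycles → Set
Proper D = ∀ (l : ℕ) → length (filter (_≟ l) (labels D)) ≤ 2

record State : Set where
  constructor ⟨_,_⟩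
  field
    D : Cycles
    g : ℕ
open State public

ProperState : State → Set
ProperState γ = Proper (D γ)

value : State → ℕ
value γ = length (deduplicate _≟_ (labels (D γ)))

Iso : Cycles → Cycles → Set
Iso D D' =
  Σ (Vtx D ↔ Vtx D') λ φ →
  Σ (Edge D ↔ Edge D') λ ψ →
    (∀ e → Inverse.to φ (src D e) ≡ src D' (Inverse.to ψ e)) ×
    (∀ e → Inverse.to φ (tgt D e) ≡ tgt D' (Inverse.to ψ e)) ×
    Σ (ℕ → ℕ) λ ρ →
      (∀ e → χ D' (Inverse.to ψ e) ≡ ρ (χ D e)) ×
      (∀ e e' → ρ (χ D e) ≡ ρ (χ D e') → χ D e ≡ χ D e')

Equivalent : State → State → Set
Equivalent γ δ = Iso (D γ) (D δ) × g γ ≡ g δ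

-- Contracting edge e_i of cycle c: the edge disappears and its ends are
-- identified; if it was a loop, the resulting isolated vertex is deleted
-- (the cycle disappears).

contractAt : (D : Cycles) (c : Fin (length D)) → Fin (size (lookup D c)) → Cycles
contractAt D c i with fromList (removeAt (head (lookup D c) ∷ tail (lookup D c)) i)
... | nothing = removeAt D c
... | just C' = C' ∷ removeAt D c

data Contraction : Cycles → Cycles → Set where
  contract : (D : Cycles) (c : Fin (length D)) (i : Fin (size (lookup D c))) →
             Contraction D (contractAt D c i)

Reduction : State → State → Set
Reduction γ δ = Star Contraction (D γ) (D δ) × g δ ≤ g γ

data Dummy : Set where
  vγ wγ : Dummy

MVtx : Cycles → Set
MVtx D = Vtx D ⊎ Dummy

removeWhere : (D : Cycles) → (Fin (length D) → Bool) → Cycles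
removeWhere [] p = []
removeWhere (C ∷ D) p with p Fin.zero
... | true  = removeWhere D (λ k → p (Fin.suc k))
... | false = C ∷ removeWhere D (λ k → p (Fin.suc k))

-- the path obtained by splitting the cycle C at vertex u_i: the edge labels
-- e_i, e_{i+1}, …, e_{i-1}  (from u_i,1 to u_i,2)
rot : (C : Cycle) → Fin (size C) → List ℕ
rot C i = drop (toℕ i) (toList C) ++ take (toℕ i) (toList C)

-- number of edges of the path from v = u_i forward to w = u_j on the same
-- cycle, in {1,…,k}; for i = j the whole cycle (the other path is trivial)
arcLen : (C : Cycle) → Fin (size C) → Fin (size C) → ℕ
arcLen C i j = suc ((toℕ j + size C ∸ suc (toℕ i)) % size C)

data Split : Set where
  -- C = C' : remaining cycles D ∖ C, and the candidate cycles Ĉ₁, Ĉ₂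
  same : (Dbar : Cycles) (C₁ C₂ : Cycle) → Split
  -- C ≠ C' : the unique resulting set of cycles
  diff : (D' : Cycles) → Split

split : (D : Cycles) → ℕ → MVtx D → MVtx D → Split
split D l (inj₁ (c , i)) (inj₁ (c' , j)) with c Fin.≟ c'
... | yes refl =
  same (removeWhere D (λ k → ⌊ k Fin.≟ c ⌋))
       (take (arcLen (lookup D c) i j) (rot (lookup D c) i) ∷ʳ l)
       (drop (arcLen (lookup D c) i j) (rot (lookup D c) i) ∷ʳ l)
... | no _ =
  diff (((rot (lookup D c) i ++ l ∷ rot (lookup D c') j) ∷ʳ l)
        ∷ removeWhere D (λ k → ⌊ k Fin.≟ c ⌋ ∨ ⌊ k Fin.≟ c' ⌋))
split D l (inj₁ (c , i)) (inj₂ _) =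
  diff (((rot (lookup D c) i ++ l ∷ []) ∷ʳ l) ∷ removeWhere D (λ k → ⌊ k Fin.≟ c ⌋))
split D l (inj₂ _) (inj₁ (c' , j)) =
  diff (((l ∷ rot (lookup D c') j) ∷ʳ l) ∷ removeWhere D (λ k → ⌊ k Fin.≟ c' ⌋))
split D l (inj₂ vγ) (inj₂ vγ) = same D (List⁺.[ l ]) (List⁺.[ l ])
split D l (inj₂ wγ) (inj₂ wγ) = same D (List⁺.[ l ]) (List⁺.[ l ])
split D l (inj₂ vγ) (inj₂ wγ) = diff ((l ∷ l ∷ []) ∷ D)
split D l (inj₂ wγ) (inj₂ vγ) = diff ((l ∷ l ∷ []) ∷ D)

-- Moves of restricted Cutter (D̄ = D_k ∖ C and ḡ = g_k in (a),(b),(c)).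

data CutterMove (γ : State) : Split → State → Set where
  move-a : ∀ {Dbar C₁ C₂} → 1 ≤ g γ →
           CutterMove γ (same Dbar C₁ C₂) ⟨ C₁ ∷ C₂ ∷ Dbar , g γ ∸ 1 ⟩
  move-b : ∀ {Dbar C₁ C₂} → CutterMove γ (same Dbar C₁ C₂) ⟨ C₁ ∷ Dbar , g γ ⟩
  move-c : ∀ {Dbar C₁ C₂} → CutterMove γ (same Dbar C₁ C₂) ⟨ C₂ ∷ Dbar , g γ ⟩
  move-d : ∀ {D'} → CutterMove γ (diff D') ⟨ D' , g γ ⟩

-- the restriction: the new state is not equivalent to a reduction of any
-- earlier game state (the list contains the current state and all earlier ones)
AvoidsReductions : List State → State → Set
AvoidsReductions earlier γ' =
  ∀ δ → δ ∈ earlier → ¬ (Σ State λ ρ → Reduction δ ρ × Equivalent γ' ρ)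

RestrictedMove : (hist : List State) (γ : State) (v w : MVtx (D γ)) (l : ℕ) → State → Set
RestrictedMove hist γ v w l γ' =
  CutterMove γ (split (D γ) l v w) γ' × AvoidsReductions (γ ∷ hist) γ'

-- A move gives its new edges a fresh label l, and every other label of the new state is an old
-- label, so the value grows by exactly one unless some old label disappears.  Labels can only
-- disappear when Cutter keeps one of the two cycles Ĉ₁ = P ∪ {f}, Ĉ₂ = P′ ∪ {f′} of a split
-- cycle C, and a label x of the discarded path occurs nowhere else.  Contracting every edge of C
-- except those of the kept path and one x-edge then leaves a cycle that, after exchanging the
-- labels x and l, is the kept cycle; so the new state is equivalent to a reduction of the current
-- one, which restricted Cutter may not play.

module Submission where

open import Defs
open import Level using (Level)
open import Data.Bool using (T; true; false; _∨_)
open import Data.Bool.Properties using (T-∨)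
open import Data.Empty using (⊥-elim)
open import Data.Nat using (ℕ; zero; suc; _+_; _*_; _≤_; _<_; _%_; z≤n; s≤s; NonZero; _≟_)
open import Data.Nat.Properties
  using (≤-refl; ≤-antisym; +-comm; +-assoc; m≤n+m; ≤-<-trans; +-monoʳ-<; +-cancelˡ-<; ≮⇒≥;
         m≤n⇒∃[o]m+o≡n; suc-injective; _<?_)
open import Data.Nat.DivMod using (m%n<n; %-distribˡ-+; m%n%n≡m%n; m<n⇒m%n≡m; [m+n]%n≡m%n; %-remove-+ˡ)
open import Data.Nat.Divisibility using (m∣m*n)
open import Data.Nat.Tactic.RingSolver using (solve-∀)
open import Data.Fin as Fin using (Fin; toℕ; fromℕ<)
open import Data.Fin.Properties using (toℕ-fromℕ<; toℕ-injective; toℕ<n)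
open import Data.List as List using (List; []; _∷_; _++_; [_]; length; lookup; removeAt; take; drop; deduplicate)
open import Data.List.Properties
  using (∷-injective; ++-assoc; ++-identityʳ; length-++; length-map; map-++; map-id-local; filter-all; take++drop≡id)
open import Data.List.NonEmpty as List⁺ using (List⁺; _∷_; toList; tail; _∷ʳ_)
open import Data.List.Membership.Propositional using (_∈_; _∉_)
open import Data.List.Membership.Propositional.Properties
  using (∈-∃++; ∈-deduplicate⁺; ∈-deduplicate⁻; ∈-lookup; ∈-++⁺ˡ; ∈-++⁺ʳ; ∈-++⁻)
open import Data.List.Membership.DecPropositional _≟_ using (_∈?_)
open import Data.List.Relation.Binary.Subset.Propositional using (_⊆_)
open import Data.List.Relation.Binary.Subset.Propositional.Properties
  using (⊆-refl; ⊆-trans; ⊆-reflexive-↭; ⊆∷∧∉⇒⊆; xs⊆x∷xs; xs⊆xs++ys; xs⊆ys++xs; ∷⁺ʳ; ∈-∷⁺ʳ; ++⁺ˡ; ++⁺ʳ)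
open import Data.List.Relation.Binary.Sublist.Propositional using ([]; _∷_; from∈) renaming (_⊆_ to _⊑_)
import Data.List.Relation.Binary.Sublist.Propositional as Sublist
import Data.List.Relation.Binary.Sublist.Propositional.Properties as Sublist
open import Data.List.Relation.Binary.Permutation.Propositional
  using (_↭_; ↭-refl; ↭-sym; ↭-trans; prep; module PermutationReasoning)
import Data.List.Relation.Binary.Permutation.Propositional.Properties as ↭
open import Data.List.Relation.Unary.All as All using (All)
open import Data.List.Relation.Unary.All.Properties using (All¬⇒¬Any)
open import Data.List.Relation.Unary.Any using (here; there)
open import Data.List.Relation.Unary.AllPairs using (_∷_)
open import Data.List.Relation.Unary.Unique.Propositional using (Unique)
open import Data.Maybe as Maybe using (Maybe; just; nothing)
open import Data.Maybe.Properties using (just-injective)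
open import Data.Product using (Σ; ∃; ∃₂; _×_; _,_)
open import Data.Sum as Sum using (_⊎_; inj₁; inj₂; [_,_]′)
open import Function using (_∘_; id; case_of_)
open import Function.Bundles using (_↔_; Inverse; Equivalence; mk↔ₛ′)
open import Function.Definitions using (Injective)
open import Function.Properties.Inverse using (↔-refl; ↔-trans)
open import Relation.Binary.Construct.Closure.ReflexiveTransitive using (Star; ε; _◅_)
open import Relation.Binary.Definitions using (DecidableEquality)
open import Relation.Binary.PropositionalEquality
  using (_≡_; _≢_; refl; sym; trans; cong; cong₂; subst; module ≡-Reasoning)
open import Relation.Nullary using (¬_; yes; no)
open import Relation.Nullary.Decidable using (⌊_⌋; toWitness)

open Inverse using (to; from)

private variable
  a b : Level
  A B : Set a

Unique⇒length≤ : ∀ {xs ys : List A} → Unique xs → xs ⊆ ys → length xs ≤ length ys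
Unique⇒length≤ {xs = []}     _               _      = z≤n
Unique⇒length≤ {xs = x ∷ xs} (x∉xs ∷ unique) x∷xs⊆ys with ∈-∃++ (x∷xs⊆ys (here refl))
... | us , vs , refl = subst (suc (length xs) ≤_) (sym (↭.↭-length (↭.shift x us vs)))
  (s≤s (Unique⇒length≤ unique (⊆∷∧∉⇒⊆ xs⊆x∷us++vs (All¬⇒¬Any x∉xs))))
  where
  xs⊆x∷us++vs : xs ⊆ x ∷ us ++ vs
  xs⊆x∷us++vs = ⊆-trans (x∷xs⊆ys ∘ there) (⊆-reflexive-↭ (↭.shift x us vs))

module _ (_≟ᴬ_ : DecidableEquality A) where

  open import Data.List.Relation.Unary.Unique.DecPropositional.Properties _≟ᴬ_ using (deduplicate-!)

  length-deduplicate-cong : ∀ {xs ys : List A} → xs ⊆ ys → ys ⊆ xs →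
                            length (deduplicate _≟ᴬ_ xs) ≡ length (deduplicate _≟ᴬ_ ys)
  length-deduplicate-cong {xs} {ys} xs⊆ys ys⊆xs = ≤-antisym
    (Unique⇒length≤ (deduplicate-! xs) (∈-deduplicate⁺ _≟ᴬ_ ∘ xs⊆ys ∘ ∈-deduplicate⁻ _≟ᴬ_ xs))
    (Unique⇒length≤ (deduplicate-! ys) (∈-deduplicate⁺ _≟ᴬ_ ∘ ys⊆xs ∘ ∈-deduplicate⁻ _≟ᴬ_ ys))

  length-deduplicate-∷ : ∀ {x} {xs : List A} → x ∉ xs →
                         length (deduplicate _≟ᴬ_ (x ∷ xs)) ≡ suc (length (deduplicate _≟ᴬ_ xs))
  length-deduplicate-∷ {x} {xs} x∉xs = cong (suc ∘ length) (filter-all _ (All.tabulate x≢))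
    where
    x≢ : ∀ {y} → y ∈ deduplicate _≟ᴬ_ xs → ¬ x ≡ y
    x≢ y∈ refl = x∉xs (∈-deduplicate⁻ _≟ᴬ_ xs y∈)

⊆-or-missing : ∀ (xs ys : List ℕ) → xs ⊆ ys ⊎ ∃ λ x → x ∈ xs × x ∉ ys
⊆-or-missing []       ys = inj₁ λ ()
⊆-or-missing (x ∷ xs) ys with x ∈? ys | ⊆-or-missing xs ys
... | no x∉ys  | _                      = inj₂ (x , here refl , x∉ys)
... | yes _    | inj₂ (z , z∈xs , z∉ys) = inj₂ (z , there z∈xs , z∉ys)
... | yes x∈ys | inj₁ xs⊆ys             = inj₁ (∈-∷⁺ʳ x∈ys xs⊆ys)

++-⊆ : ∀ {xs ys zs : List A} → xs ⊆ zs → ys ⊆ zs → xs ++ ys ⊆ zs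
++-⊆ {xs = xs} xs⊆zs ys⊆zs = [ xs⊆zs , ys⊆zs ]′ ∘ ∈-++⁻ xs

Rotation : List A → List A → Set _
Rotation {A = A} xs ys = ∃₂ λ (us vs : List A) → xs ≡ us ++ vs × ys ≡ vs ++ us

rotation⇒↭ : ∀ {xs ys : List A} → Rotation xs ys → xs ↭ ys
rotation⇒↭ (us , vs , refl , refl) = ↭.++-comm us vs

++-Levi : ∀ (xs ys us vs : List A) → xs ++ ys ≡ us ++ vs →
          (∃ λ ws → us ≡ xs ++ ws × ys ≡ ws ++ vs) ⊎ (∃ λ ws → xs ≡ us ++ ws × vs ≡ ws ++ ys)
++-Levi []       ys us       vs eq = inj₁ (us , refl , eq)
++-Levi (x ∷ xs) ys []       vs eq = inj₂ (x ∷ xs , refl , sym eq)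
++-Levi (x ∷ xs) ys (u ∷ us) vs eq with ∷-injective eq
... | refl , eq′ with ++-Levi xs ys us vs eq′
...   | inj₁ (ws , refl , ys≡) = inj₁ (ws , refl , ys≡)
...   | inj₂ (ws , refl , vs≡) = inj₂ (ws , refl , vs≡)

rotation-swap : ∀ {xs : List A} us vs → Rotation xs (us ++ vs) → Rotation xs (vs ++ us)
rotation-swap us vs (ps , qs , refl , eq) with ++-Levi qs ps us vs (sym eq)
... | inj₁ (ws , refl , refl) = ws , vs ++ qs , ++-assoc ws vs qs , sym (++-assoc vs qs ws)
... | inj₂ (ws , refl , refl) = ps ++ us , ws , sym (++-assoc ps us ws) , ++-assoc ws ps us

⊑-++⁻ : ∀ {ws} (xs ys : List A) → ws ⊑ xs ++ ys → ∃₂ λ (us vs : List A) → ws ≡ us ++ vs × us ⊑ xs × vs ⊑ ys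
⊑-++⁻ []       ys p = [] , _ , refl , [] , p
⊑-++⁻ (x ∷ xs) ys (.x Sublist.∷ʳ p) with ⊑-++⁻ xs ys p
... | us , vs , refl , q , r = us , vs , refl , x Sublist.∷ʳ q , r
⊑-++⁻ (x ∷ xs) ys (refl ∷ p) with ⊑-++⁻ xs ys p
... | us , vs , refl , q , r = x ∷ us , vs , refl , refl ∷ q , r

⊑-rotation : ∀ {ws xs ys : List A} → ws ⊑ ys → Rotation xs ys → ∃ λ ws′ → Rotation ws ws′ × ws′ ⊑ xs
⊑-rotation p (us , vs , refl , refl) with ⊑-++⁻ vs us p
... | ps , qs , refl , q , r = qs ++ ps , (ps , qs , refl , refl) , Sublist.++⁺ r q

at : List A → ℕ → Maybe A
at []       _       = nothing
at (x ∷ xs) zero    = just x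
at (x ∷ xs) (suc n) = at xs n

at-lookup : ∀ (xs : List A) i → at xs (toℕ i) ≡ just (lookup xs i)
at-lookup (x ∷ xs) Fin.zero    = refl
at-lookup (x ∷ xs) (Fin.suc i) = at-lookup xs i

at-map : ∀ (f : A → B) xs n → at (List.map f xs) n ≡ Maybe.map f (at xs n)
at-map f []       n       = refl
at-map f (x ∷ xs) zero    = refl
at-map f (x ∷ xs) (suc n) = at-map f xs n

at-++ˡ : ∀ (xs : List A) {ys n} → n < length xs → at (xs ++ ys) n ≡ at xs n
at-++ˡ (x ∷ xs) {n = zero}  _          = refl
at-++ˡ (x ∷ xs) {n = suc n} (s≤s n<xs) = at-++ˡ xs n<xs

at-++ʳ : ∀ (xs : List A) {ys} n → at (xs ++ ys) (length xs + n) ≡ at ys n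
at-++ʳ []       n = refl
at-++ʳ (x ∷ xs) n = at-++ʳ xs n

at-rotate : ∀ (xs ys : List A) {k n} → length xs + length ys ≡ suc k → n < suc k →
            at (ys ++ xs) ((length ys + n) % suc k) ≡ at (xs ++ ys) n
at-rotate xs ys {k} {n} xs+ys n<k with n <? length xs
... | yes n<xs = begin
  at (ys ++ xs) ((length ys + n) % suc k) ≡⟨ cong (at (ys ++ xs)) (m<n⇒m%n≡m ys+n<k) ⟩
  at (ys ++ xs) (length ys + n)           ≡⟨ at-++ʳ ys {xs} n ⟩
  at xs n                                 ≡⟨ at-++ˡ xs {ys} n<xs ⟨
  at (xs ++ ys) n                         ∎
  where
  open ≡-Reasoning
  ys+n<k : length ys + n < suc k
  ys+n<k = subst (length ys + n <_) (trans (+-comm (length ys) (length xs)) xs+ys)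
                 (+-monoʳ-< (length ys) n<xs)
... | no n≮xs with m≤n⇒∃[o]m+o≡n (≮⇒≥ n≮xs)
...   | j , refl = begin
  at (ys ++ xs) ((length ys + (length xs + j)) % suc k) ≡⟨ cong (λ m → at (ys ++ xs) (m % suc k)) wrap ⟩
  at (ys ++ xs) ((j + suc k) % suc k)                   ≡⟨ cong (at (ys ++ xs)) ([m+n]%n≡m%n j (suc k)) ⟩
  at (ys ++ xs) (j % suc k)                             ≡⟨ cong (at (ys ++ xs)) (m<n⇒m%n≡m j<k) ⟩
  at (ys ++ xs) j                                       ≡⟨ at-++ˡ ys {xs} j<ys ⟩
  at ys j                                               ≡⟨ at-++ʳ xs {ys} j ⟨
  at (xs ++ ys) (length xs + j)                         ∎
  where
  open ≡-Reasoning
  j<k : j < suc k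
  j<k = ≤-<-trans (m≤n+m j (length xs)) n<k
  j<ys : j < length ys
  j<ys = +-cancelˡ-< (length xs) j (length ys) (subst (length xs + j <_) (sym xs+ys) n<k)
  wrap : length ys + (length xs + j) ≡ j + suc k
  wrap = trans (shuffle (length xs) (length ys) j) (cong (j +_) xs+ys)
    where
    shuffle : ∀ x y z → y + (x + z) ≡ z + (x + y)
    shuffle = solve-∀

rotateBy : ∀ {k k′} → ℕ → Fin (suc k) → Fin (suc k′)
rotateBy {k′ = k′} s i = fromℕ< (m%n<n (s + toℕ i) (suc k′))

toℕ-rotateBy : ∀ {k k′} s (i : Fin (suc k)) → toℕ (rotateBy {k′ = k′} s i) ≡ (s + toℕ i) % suc k′
toℕ-rotateBy s i = toℕ-fromℕ< _

[m+n%d]%d≡[m+n]%d : ∀ m n d .{{_ : NonZero d}} → (m + n % d) % d ≡ (m + n) % d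
[m+n%d]%d≡[m+n]%d m n d = begin
  (m + n % d) % d           ≡⟨ %-distribˡ-+ m (n % d) d ⟩
  (m % d + n % d % d) % d   ≡⟨ cong (λ r → (m % d + r) % d) (m%n%n≡m%n n d) ⟩
  (m % d + n % d) % d       ≡⟨ %-distribˡ-+ m n d ⟨
  (m + n) % d               ∎
  where open ≡-Reasoning

rotateBy-rotateBy : ∀ {k} s t (i : Fin (suc k)) → rotateBy s (rotateBy t i) ≡ rotateBy (s + t) i
rotateBy-rotateBy {k} s t i = toℕ-injective (begin
  toℕ (rotateBy s (rotateBy t i))   ≡⟨ toℕ-rotateBy s (rotateBy t i) ⟩
  (s + toℕ (rotateBy t i)) % suc k  ≡⟨ cong (λ r → (s + r) % suc k) (toℕ-rotateBy t i) ⟩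
  (s + (t + toℕ i) % suc k) % suc k ≡⟨ [m+n%d]%d≡[m+n]%d s (t + toℕ i) (suc k) ⟩
  (s + (t + toℕ i)) % suc k         ≡⟨ cong (_% suc k) (+-assoc s t (toℕ i)) ⟨
  (s + t + toℕ i) % suc k           ≡⟨ toℕ-rotateBy (s + t) i ⟨
  toℕ (rotateBy (s + t) i)          ∎)
  where open ≡-Reasoning

rotateBy-full : ∀ {k} m (i : Fin (suc k)) → rotateBy (suc k * m) i ≡ i
rotateBy-full {k} m i = toℕ-injective (begin
  toℕ (rotateBy (suc k * m) i)     ≡⟨ toℕ-rotateBy (suc k * m) i ⟩
  (suc k * m + toℕ i) % suc k      ≡⟨ %-remove-+ˡ (toℕ i) (m∣m*n m) ⟩
  toℕ i % suc k                    ≡⟨ m<n⇒m%n≡m (toℕ<n i) ⟩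
  toℕ i                            ∎)
  where open ≡-Reasoning

record _≃⟨_⟩_ {k k′} (f : Fin (suc k) → ℕ) (ρ : ℕ → ℕ) (g : Fin (suc k′) → ℕ) : Set where
  field
    position : Fin (suc k) ↔ Fin (suc k′)
    next-commute : ∀ i → to position (next i) ≡ next (to position i)
    relabel : ∀ i → g (to position i) ≡ ρ (f i)

rotation-≃ : ∀ {k k′ ρ} {f : Fin (suc k) → ℕ} {g : Fin (suc k′) → ℕ} s → k ≡ k′ →
             (∀ i → g (rotateBy s i) ≡ ρ (f i)) → f ≃⟨ ρ ⟩ g
rotation-≃ {k} s refl relabel = record
  { position = mk↔ₛ′ (rotateBy s) (rotateBy (k * s)) to-from from-to
  -- next is rotateBy 1 by definition
  ; next-commute = λ i → trans (rotateBy-rotateBy s 1 i)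
                         (trans (cong (λ r → rotateBy r i) (+-comm s 1)) (sym (rotateBy-rotateBy 1 s i)))
  ; relabel = relabel
  }
  where
  to-from : ∀ i → rotateBy s (rotateBy (k * s) i) ≡ i
  to-from i = trans (rotateBy-rotateBy s (k * s) i) (rotateBy-full s i)
  from-to : ∀ i → rotateBy (k * s) (rotateBy s i) ≡ i
  from-to i = trans (rotateBy-rotateBy (k * s) s i)
                    (trans (cong (λ r → rotateBy r i) (+-comm (k * s) s)) (rotateBy-full s i))

≃-refl : ∀ {C} → lab C ≃⟨ id ⟩ lab C
≃-refl = record { position = ↔-refl ; next-commute = λ _ → refl ; relabel = λ _ → refl }

relabelled-rotation-≃ : ∀ {ρ} (C C′ : Cycle) → Rotation (List.map ρ (toList C)) (toList C′) → lab C ≃⟨ ρ ⟩ lab C′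
relabelled-rotation-≃ {ρ} C C′ (us , vs , ρC≡us++vs , C′≡vs++us) = rotation-≃ (length vs) k≡k′ relabel
  where
  open ≡-Reasoning
  us+vs≡size : length us + length vs ≡ size C′
  us+vs≡size = trans (+-comm (length us) (length vs))
                     (trans (sym (length-++ vs)) (cong length (sym C′≡vs++us)))
  k≡k′ : length (tail C) ≡ length (tail C′)
  k≡k′ = suc-injective (trans (sym (length-map ρ (toList C)))
                       (trans (cong length ρC≡us++vs) (trans (length-++ us) us+vs≡size)))
  toℕ<size : ∀ i → toℕ i < size C′
  toℕ<size i = subst (λ k → toℕ i < suc k) k≡k′ (toℕ<n i)
  relabel : ∀ i → lab C′ (rotateBy (length vs) i) ≡ ρ (lab C i)
  relabel i = just-injective (begin
    just (lab C′ (rotateBy (length vs) i))         ≡⟨ at-lookup (toList C′) (rotateBy (length vs) i) ⟨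
    at (toList C′) (toℕ (rotateBy (length vs) i))  ≡⟨ cong (at (toList C′)) (toℕ-rotateBy (length vs) i) ⟩
    at (toList C′) ((length vs + toℕ i) % size C′) ≡⟨ cong (λ xs → at xs _) C′≡vs++us ⟩
    at (vs ++ us) ((length vs + toℕ i) % size C′)  ≡⟨ at-rotate us vs us+vs≡size (toℕ<size i) ⟩
    at (us ++ vs) (toℕ i)                          ≡⟨ cong (λ xs → at xs (toℕ i)) ρC≡us++vs ⟨
    at (List.map ρ (toList C)) (toℕ i)             ≡⟨ at-map ρ (toList C) (toℕ i) ⟩
    Maybe.map ρ (at (toList C) (toℕ i))            ≡⟨ cong (Maybe.map ρ) (at-lookup (toList C) i) ⟩
    just (ρ (lab C i))                             ∎)

toList-∷ʳ : ∀ (xs : List A) x → toList (xs ∷ʳ x) ≡ xs ++ [ x ]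
toList-∷ʳ []      x = refl
toList-∷ʳ (_ ∷ _) x = refl

toList-∷ʳ↭ : ∀ (xs : List A) x → toList (xs ∷ʳ x) ↭ x ∷ xs
toList-∷ʳ↭ xs x = subst (_↭ x ∷ xs) (sym (toList-∷ʳ xs x)) (↭-sym (↭.∷↭∷ʳ x xs))

toList-injective : ∀ {C C′ : List⁺ A} → toList C ≡ toList C′ → C ≡ C′
toList-injective {C = _ ∷ _} {_ ∷ _} refl = refl

rotation-cycle : ∀ (C : List⁺ A) {ys} → Rotation (toList C) ys → ∃ λ (C′ : List⁺ A) → toList C′ ≡ ys
rotation-cycle C (us , []     , C≡us++[] , refl) = C , trans C≡us++[] (++-identityʳ us)
rotation-cycle C (us , v ∷ vs , _        , refl) = (v ∷ vs ++ us) , refl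

rot-rotation : ∀ C i → Rotation (toList C) (rot C i)
rot-rotation C i = take (toℕ i) (toList C) , drop (toℕ i) (toList C) , sym (take++drop≡id (toℕ i) (toList C)) , refl

toList⊆rot : ∀ C i → toList C ⊆ rot C i
toList⊆rot C i = ⊆-reflexive-↭ (rotation⇒↭ (rot-rotation C i))

toList⊆labels : ∀ D c → toList (lookup D c) ⊆ labels D
toList⊆labels (C ∷ D) Fin.zero    = xs⊆xs++ys (toList C) (labels D)
toList⊆labels (C ∷ D) (Fin.suc c) = ⊆-trans (toList⊆labels D c) (xs⊆ys++xs (labels D) (toList C))

rot⊆labels : ∀ D c i → rot (lookup D c) i ⊆ labels D
rot⊆labels D c i = ⊆-trans (⊆-reflexive-↭ (↭-sym (rotation⇒↭ (rot-rotation (lookup D c) i)))) (toList⊆labels D c)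

χ∈labels : ∀ D e → χ D e ∈ labels D
χ∈labels D (c , i) = toList⊆labels D c (∈-lookup i)

labels-removeAt : ∀ D c → labels D ↭ toList (lookup D c) ++ labels (removeAt D c)
labels-removeAt (C ∷ D) Fin.zero    = ↭-refl
labels-removeAt (C ∷ D) (Fin.suc c) =
  ↭-trans (↭.++⁺ˡ (toList C) (labels-removeAt D c)) (↭.shifts (toList C) (toList (lookup D c)))

removeWhere-false : ∀ D → removeWhere D (λ _ → false) ≡ D
removeWhere-false []      = refl
removeWhere-false (C ∷ D) = cong (C ∷_) (removeWhere-false D)

removeWhere-cong : ∀ D {p q} → (∀ k → p k ≡ q k) → removeWhere D p ≡ removeWhere D q
removeWhere-cong []      _   = refl
removeWhere-cong (C ∷ D) {p} {q} p≗q with p Fin.zero | q Fin.zero | p≗q Fin.zero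
... | true  | _ | refl = removeWhere-cong D (p≗q ∘ Fin.suc)
... | false | _ | refl = cong (C ∷_) (removeWhere-cong D (p≗q ∘ Fin.suc))

-- Not definitional: ⌊_⌋ does not compute through the Dec.map′ in Fin._≟_.
isYes-suc≟suc : ∀ {n} (k c : Fin n) → ⌊ Fin.suc k Fin.≟ Fin.suc c ⌋ ≡ ⌊ k Fin.≟ c ⌋
isYes-suc≟suc k c with k Fin.≟ c
... | yes _ = refl
... | no _  = refl

removeWhere-≟ : ∀ D c → removeWhere D (λ k → ⌊ k Fin.≟ c ⌋) ≡ removeAt D c
removeWhere-≟ (C ∷ D) Fin.zero    = removeWhere-false D
removeWhere-≟ (C ∷ D) (Fin.suc c) =
  cong (C ∷_) (trans (removeWhere-cong D λ k → isYes-suc≟suc k c) (removeWhere-≟ D c))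

labels-removeWhere⊆ : ∀ D p → labels (removeWhere D p) ⊆ labels D
labels-removeWhere⊆ []      p = id
labels-removeWhere⊆ (C ∷ D) p with p Fin.zero
... | true  = ⊆-trans (labels-removeWhere⊆ D _) (xs⊆ys++xs (labels D) (toList C))
... | false = ++⁺ʳ (toList C) (labels-removeWhere⊆ D _)

labels⊆removeWhere : ∀ D p {X} → (∀ k → T (p k) → toList (lookup D k) ⊆ X) →
                     labels D ⊆ X ++ labels (removeWhere D p)
labels⊆removeWhere []      p         removed⊆X = λ ()
labels⊆removeWhere (C ∷ D) p {X} removed⊆X with p Fin.zero | removed⊆X Fin.zero
... | true  | C⊆X = [ ∈-++⁺ˡ ∘ C⊆X _ , rest ]′ ∘ ∈-++⁻ (toList C)
  where rest = labels⊆removeWhere D _ (removed⊆X ∘ Fin.suc)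
... | false | _   = [ ∈-++⁺ʳ X ∘ ∈-++⁺ˡ , ⊆-trans rest (++⁺ʳ X (xs⊆ys++xs _ (toList C))) ]′ ∘ ∈-++⁻ (toList C)
  where rest = labels⊆removeWhere D _ (removed⊆X ∘ Fin.suc)

record _≅⟨_⟩_ (D : Cycles) (ρ : ℕ → ℕ) (D′ : Cycles) : Set where
  field
    vertex : Vtx D ↔ Vtx D′
    tgt-commute : ∀ e → to vertex (tgt D e) ≡ tgt D′ (to vertex e)
    relabel : ∀ e → χ D′ (to vertex e) ≡ ρ (χ D e)

≅⇒Iso : ∀ {D D′ ρ} → Injective _≡_ _≡_ ρ → D ≅⟨ ρ ⟩ D′ → Iso D D′
≅⇒Iso {ρ = ρ} ρ-injective D≅D′ =
  vertex , vertex , (λ _ → refl) , tgt-commute , ρ , relabel , λ _ _ → ρ-injective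
  where open _≅⟨_⟩_ D≅D′

≅-fix : ∀ {D ρ} → (∀ {y} → y ∈ labels D → ρ y ≡ y) → D ≅⟨ ρ ⟩ D
≅-fix {D} ρ-fix = record
  { vertex = ↔-refl ; tgt-commute = λ _ → refl ; relabel = λ e → sym (ρ-fix (χ∈labels D e)) }

≅-refl : ∀ {D} → D ≅⟨ id ⟩ D
≅-refl = ≅-fix λ _ → refl

≅-trans : ∀ {D₁ D₂ D₃ ρ σ} → D₁ ≅⟨ ρ ⟩ D₂ → D₂ ≅⟨ σ ⟩ D₃ → D₁ ≅⟨ σ ∘ ρ ⟩ D₃
≅-trans {σ = σ} D₁≅D₂ D₂≅D₃ = record
  { vertex = ↔-trans (vertex D₁≅D₂) (vertex D₂≅D₃)
  ; tgt-commute = λ e → trans (cong (to (vertex D₂≅D₃)) (tgt-commute D₁≅D₂ e)) (tgt-commute D₂≅D₃ _)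
  ; relabel = λ e → trans (relabel D₂≅D₃ _) (cong σ (relabel D₁≅D₂ e))
  }
  where open _≅⟨_⟩_

weaken : ∀ {C D} → Vtx D → Vtx (C ∷ D)
weaken (c , i) = Fin.suc c , i

∷-≅ : ∀ {C C′ D D′ ρ} → lab C ≃⟨ ρ ⟩ lab C′ → D ≅⟨ ρ ⟩ D′ → (C ∷ D) ≅⟨ ρ ⟩ (C′ ∷ D′)
∷-≅ {C} {C′} {D} {D′} C≃C′ D≅D′ = record
  { vertex = mk↔ₛ′ forth back forth∘back back∘forth
  ; tgt-commute = λ { (Fin.zero , i) → cong (Fin.zero ,_) (next-commute i)
                    ; (Fin.suc c , i) → cong (weaken {C′}) (tgt-commute (c , i)) }
  ; relabel = λ { (Fin.zero , i) → C≃C′.relabel i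
                ; (Fin.suc c , i) → relabel (c , i) }
  }
  where
  open _≃⟨_⟩_ C≃C′ hiding (relabel)
  module C≃C′ = _≃⟨_⟩_ C≃C′
  open _≅⟨_⟩_ D≅D′
  forth : Vtx (C ∷ D) → Vtx (C′ ∷ D′)
  forth (Fin.zero , i)  = Fin.zero , to position i
  forth (Fin.suc c , i) = weaken (to vertex (c , i))
  back : Vtx (C′ ∷ D′) → Vtx (C ∷ D)
  back (Fin.zero , i)  = Fin.zero , from position i
  back (Fin.suc c , i) = weaken (from vertex (c , i))
  forth∘back : ∀ v → forth (back v) ≡ v
  forth∘back (Fin.zero , i)  = cong (Fin.zero ,_) (Inverse.strictlyInverseˡ position i)
  forth∘back (Fin.suc c , i) = cong weaken (Inverse.strictlyInverseˡ vertex (c , i))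
  back∘forth : ∀ v → back (forth v) ≡ v
  back∘forth (Fin.zero , i)  = cong (Fin.zero ,_) (Inverse.strictlyInverseʳ position i)
  back∘forth (Fin.suc c , i) = cong weaken (Inverse.strictlyInverseʳ vertex (c , i))

exchange : ∀ {A B E} → Vtx (A ∷ B ∷ E) → Vtx (B ∷ A ∷ E)
exchange (Fin.zero , i)              = Fin.suc Fin.zero , i
exchange (Fin.suc Fin.zero , i)      = Fin.zero , i
exchange (Fin.suc (Fin.suc c) , i)   = Fin.suc (Fin.suc c) , i

exchange-involutive : ∀ {A B E} (v : Vtx (A ∷ B ∷ E)) → exchange {B} {A} (exchange v) ≡ v
exchange-involutive (Fin.zero , i)            = refl
exchange-involutive (Fin.suc Fin.zero , i)    = refl
exchange-involutive (Fin.suc (Fin.suc c) , i) = refl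

exchange-≅ : ∀ {A B E} → (A ∷ B ∷ E) ≅⟨ id ⟩ (B ∷ A ∷ E)
exchange-≅ {A} {B} = record
  { vertex = mk↔ₛ′ exchange exchange (exchange-involutive {B} {A}) (exchange-involutive {A} {B})
  ; tgt-commute = λ { (Fin.zero , i) → refl ; (Fin.suc Fin.zero , i) → refl ; (Fin.suc (Fin.suc c) , i) → refl }
  ; relabel = λ { (Fin.zero , i) → refl ; (Fin.suc Fin.zero , i) → refl ; (Fin.suc (Fin.suc c) , i) → refl }
  }

lookup∷removeAt-≅ : ∀ D c → (lookup D c ∷ removeAt D c) ≅⟨ id ⟩ D
lookup∷removeAt-≅ (C ∷ D) Fin.zero    = ≅-refl
lookup∷removeAt-≅ (C ∷ D) (Fin.suc c) = ≅-trans exchange-≅ (∷-≅ (≃-refl {C}) (lookup∷removeAt-≅ D c))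

removeAt-middle : ∀ (xs : List A) y ys → ∃ λ i → removeAt (xs ++ y ∷ ys) i ≡ xs ++ ys
removeAt-middle []       y ys = Fin.zero , refl
removeAt-middle (x ∷ xs) y ys with removeAt-middle xs y ys
... | i , eq = Fin.suc i , cong (x ∷_) eq

⊒-cycle : ∀ {xs ys} (C : Cycle) → toList C ≡ xs → xs ⊑ ys → ∃ λ C′ → toList C′ ≡ ys
⊒-cycle C () []
⊒-cycle C _  (y Sublist.∷ʳ _) = (y ∷ _) , refl
⊒-cycle C _  (_∷_ {y = y} _ _) = (y ∷ _) , refl

contraction : ∀ D c i (C′ : Cycle) → toList C′ ≡ removeAt (toList (lookup D c)) i →
              Contraction D (C′ ∷ removeAt D c)
contraction D c i C′ eq = subst (Contraction D) contracted (contract D c i)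
  where
  contracted : contractAt D c i ≡ C′ ∷ removeAt D c
  contracted rewrite sym eq = refl

-- The prefix P of the cycle has been dealt with; every label skipped by xs ⊑ ys is contracted,
-- and after the first contraction the cycle sits at the front of the list.
contract-to-sublist : ∀ P {xs ys} → xs ⊑ ys → ∀ D c (Cs : Cycle) →
  toList (lookup D c) ≡ P ++ ys → toList Cs ≡ P ++ xs →
  ∃ λ D′ → Star Contraction D D′ × (Cs ∷ removeAt D c) ≅⟨ id ⟩ D′
contract-to-sublist P [] D c Cs eqC eqCs
  rewrite toList-injective {C = Cs} {lookup D c} (trans eqCs (sym eqC)) = D , ε , lookup∷removeAt-≅ D c
contract-to-sublist P (_∷_ {x = x} refl p) D c Cs eqC eqCs =
  contract-to-sublist (P ++ [ x ]) p D c Cs (trans eqC (sym (++-assoc P [ x ] _)))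
                                            (trans eqCs (sym (++-assoc P [ x ] _)))
contract-to-sublist P (y Sublist.∷ʳ p) D c Cs eqC eqCs
  with subst (λ zs → ∃ λ i → removeAt zs i ≡ P ++ _) (sym eqC) (removeAt-middle P y _)
     | ⊒-cycle Cs eqCs (Sublist.++⁺ (Sublist.⊆-refl {x = P}) p)
... | i , removed | C₁ , eqC₁ with contract-to-sublist P p (C₁ ∷ removeAt D c) Fin.zero Cs eqC₁ eqCs
...   | D′ , contractions , iso = D′ , contraction D c i C₁ (trans eqC₁ (sym removed)) ◅ contractions , iso

-- Losing a label yields a reduction

module Transposition (_≟ᴬ_ : DecidableEquality A) where

  transpose : A → A → A → A
  transpose a b y with y ≟ᴬ a | y ≟ᴬ b
  ... | yes _ | _     = b
  ... | no _  | yes _ = a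
  ... | no _  | no _  = y

  transpose-fix : ∀ {a b y} → y ≢ a → y ≢ b → transpose a b y ≡ y
  transpose-fix {a} {b} {y} y≢a y≢b with y ≟ᴬ a | y ≟ᴬ b
  ... | yes y≡a | _       = ⊥-elim (y≢a y≡a)
  ... | no _    | yes y≡b = ⊥-elim (y≢b y≡b)
  ... | no _    | no _    = refl

  transpose-left : ∀ a b → transpose a b a ≡ b
  transpose-left a b with a ≟ᴬ a
  ... | yes _  = refl
  ... | no a≢a = ⊥-elim (a≢a refl)

  transpose-right : ∀ a b → transpose a b b ≡ a
  transpose-right a b with b ≟ᴬ a | b ≟ᴬ b
  ... | yes b≡a | _      = b≡a
  ... | no _    | yes _  = refl
  ... | no _    | no b≢b = ⊥-elim (b≢b refl)

  transpose-involutive : ∀ a b y → transpose a b (transpose a b y) ≡ y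
  transpose-involutive a b y with y ≟ᴬ a | y ≟ᴬ b
  ... | yes refl | _        = transpose-right y b
  ... | no _     | yes refl = transpose-left a y
  ... | no y≢a   | no y≢b   = transpose-fix y≢a y≢b

  transpose-injective : ∀ a b → Injective _≡_ _≡_ (transpose a b)
  transpose-injective a b {y} {z} eq =
    trans (sym (transpose-involutive a b y)) (trans (cong (transpose a b) eq) (transpose-involutive a b z))

open Transposition _≟_

rotated-sublist-cycle : ∀ {L K K′ x} → Rotation L (K ++ K′) → x ∈ K′ →
                        ∃ λ (Cs : Cycle) → Rotation (toList (K ∷ʳ x)) (toList Cs) × toList Cs ⊑ L
rotated-sublist-cycle {K = K} {K′} {x} rotation x∈K′ with ⊑-rotation K∷ʳx⊑K++K′ rotation
  where
  K∷ʳx⊑K++K′ : toList (K ∷ʳ x) ⊑ K ++ K′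
  K∷ʳx⊑K++K′ = subst (_⊑ K ++ K′) (sym (toList-∷ʳ K x)) (Sublist.++⁺ (Sublist.⊆-refl {x = K}) (from∈ x∈K′))
... | ws , K∷ʳx↻ws , ws⊑L with rotation-cycle (K ∷ʳ x) K∷ʳx↻ws
...   | Cs , refl = Cs , K∷ʳx↻ws , ws⊑L

record CycleSplit (D : Cycles) : Set where
  field
    cycle    : Fin (List.length D)
    path₁    : List ℕ
    path₂    : List ℕ
    rotation : Rotation (toList (lookup D cycle)) (path₁ ++ path₂)

  rest : Cycles
  rest = removeAt D cycle

  labels↭ : labels D ↭ (path₁ ++ path₂) ++ labels rest
  labels↭ = ↭-trans (labels-removeAt D cycle) (↭.++⁺ʳ _ (rotation⇒↭ rotation))

  swapped : CycleSplit D
  swapped = record { cycle = cycle ; path₁ = path₂ ; path₂ = path₁ ; rotation = rotation-swap path₁ path₂ rotation }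

lost-label⇒reduction : ∀ {D g x l} (σ : CycleSplit D) → let open CycleSplit σ in
  l ∉ labels D → x ∈ path₂ → x ∉ path₁ → x ∉ labels rest →
  Σ State λ δ → Reduction ⟨ D , g ⟩ δ × Equivalent ⟨ (path₁ ∷ʳ l) ∷ rest , g ⟩ δ
lost-label⇒reduction {D} {g} {x} {l} σ l∉D x∈K′ x∉K x∉R
  with rotated-sublist-cycle (CycleSplit.rotation σ) x∈K′
... | Cs , K∷ʳx↻Cs , Cs⊑C with contract-to-sublist [] Cs⊑C D (CycleSplit.cycle σ) Cs refl refl
...   | D′ , contractions , Cs∷R≅D′ =
  ⟨ D′ , g ⟩ , (contractions , ≤-refl) , ≅⇒Iso (transpose-injective l x) (≅-trans kept≅Cs∷R Cs∷R≅D′) , refl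
  where
  open CycleSplit σ renaming (path₁ to K; path₂ to K′; rest to R)
  open ≡-Reasoning
  τ = transpose l x
  K⊆D : K ⊆ labels D
  K⊆D = ⊆-trans (xs⊆xs++ys K K′) (⊆-trans (xs⊆xs++ys _ (labels R)) (⊆-reflexive-↭ (↭-sym labels↭)))
  R⊆D : labels R ⊆ labels D
  R⊆D = ⊆-trans (xs⊆ys++xs (labels R) _) (⊆-reflexive-↭ (↭-sym labels↭))
  τ-fixes-K : All (λ y → τ y ≡ y) K
  τ-fixes-K = All.tabulate λ y∈K → transpose-fix (λ { refl → l∉D (K⊆D y∈K) }) (λ { refl → x∉K y∈K })
  relabelled : List.map τ (toList (K ∷ʳ l)) ≡ toList (K ∷ʳ x)
  relabelled = begin
    List.map τ (toList (K ∷ʳ l)) ≡⟨ cong (List.map τ) (toList-∷ʳ K l) ⟩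
    List.map τ (K ++ [ l ])      ≡⟨ map-++ τ K [ l ] ⟩
    List.map τ K ++ [ τ l ]      ≡⟨ cong₂ (λ ys y → ys ++ [ y ]) (map-id-local τ-fixes-K) (transpose-left l x) ⟩
    K ++ [ x ]                   ≡⟨ toList-∷ʳ K x ⟨
    toList (K ∷ʳ x)              ∎
  kept≅Cs∷R : ((K ∷ʳ l) ∷ R) ≅⟨ τ ⟩ (Cs ∷ R)
  kept≅Cs∷R = ∷-≅ (relabelled-rotation-≃ (K ∷ʳ l) Cs (subst (λ zs → Rotation zs (toList Cs)) (sym relabelled) K∷ʳx↻Cs))
                  (≅-fix λ y∈R → transpose-fix (λ { refl → l∉D (R⊆D y∈R) }) (λ { refl → x∉R y∈R }))

value-fresh : ∀ γ γ′ {l} → l ∉ labels (D γ) → labels (D γ′) ⊆ l ∷ labels (D γ) → l ∷ labels (D γ) ⊆ labels (D γ′) →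
              value γ′ ≡ suc (value γ)
value-fresh _ _ l∉D D′⊆ ⊆D′ = trans (length-deduplicate-cong _≟_ D′⊆ ⊆D′) (length-deduplicate-∷ _≟_ l∉D)

module _ {D : Cycles} (σ : CycleSplit D) (l : ℕ) where

  open CycleSplit σ

  both-paths-labels : labels ((path₁ ∷ʳ l) ∷ (path₂ ∷ʳ l) ∷ rest) ↭ l ∷ l ∷ labels D
  both-paths-labels = begin
    toList (path₁ ∷ʳ l) ++ toList (path₂ ∷ʳ l) ++ R ↭⟨ ↭.++⁺ (toList-∷ʳ↭ path₁ l) (↭.++⁺ʳ R (toList-∷ʳ↭ path₂ l)) ⟩
    l ∷ path₁ ++ l ∷ path₂ ++ R                     ↭⟨ prep l (↭.shift l path₁ (path₂ ++ R)) ⟩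
    l ∷ l ∷ path₁ ++ path₂ ++ R                     ≡⟨ cong (λ zs → l ∷ l ∷ zs) (++-assoc path₁ path₂ R) ⟨
    l ∷ l ∷ (path₁ ++ path₂) ++ R                   ↭⟨ prep l (prep l (↭-sym labels↭)) ⟩
    l ∷ l ∷ labels D                                ∎
    where
    open PermutationReasoning
    R = labels rest

  first-path-labels : labels ((path₁ ∷ʳ l) ∷ rest) ↭ l ∷ path₁ ++ labels rest
  first-path-labels = ↭.++⁺ʳ (labels rest) (toList-∷ʳ↭ path₁ l)

  first-path∪rest⊆labels : path₁ ++ labels rest ⊆ labels D
  first-path∪rest⊆labels = ⊆-trans (++⁺ˡ (labels rest) (xs⊆xs++ys path₁ path₂)) (⊆-reflexive-↭ (↭-sym labels↭))

  labels⊆first-path∪rest : ∀ {g} hist → l ∉ labels D →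
    AvoidsReductions (⟨ D , g ⟩ ∷ hist) ⟨ (path₁ ∷ʳ l) ∷ rest , g ⟩ → labels D ⊆ path₁ ++ labels rest
  labels⊆first-path∪rest {g} hist l∉D avoids with ⊆-or-missing (labels D) (path₁ ++ labels rest)
  ... | inj₁ D⊆ = D⊆
  ... | inj₂ (x , x∈D , x∉) with ∈-++⁻ (path₁ ++ path₂) (⊆-reflexive-↭ labels↭ x∈D)
  ...   | inj₂ x∈rest = ⊥-elim (x∉ (∈-++⁺ʳ path₁ x∈rest))
  ...   | inj₁ x∈paths with ∈-++⁻ path₁ x∈paths
  ...     | inj₁ x∈path₁ = ⊥-elim (x∉ (∈-++⁺ˡ x∈path₁))
  ...     | inj₂ x∈path₂ = ⊥-elim (avoids ⟨ D , g ⟩ (here refl)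
                             (lost-label⇒reduction σ l∉D x∈path₂ (x∉ ∘ ∈-++⁺ˡ) (x∉ ∘ ∈-++⁺ʳ path₁)))

keep-first-value : ∀ {D g l} (σ : CycleSplit D) hist → l ∉ labels D →
  let open CycleSplit σ in AvoidsReductions (⟨ D , g ⟩ ∷ hist) ⟨ (path₁ ∷ʳ l) ∷ rest , g ⟩ →
  value ⟨ (path₁ ∷ʳ l) ∷ rest , g ⟩ ≡ suc (value ⟨ D , g ⟩)
keep-first-value {D} {g} {l} σ hist l∉D avoids = value-fresh ⟨ D , g ⟩ ⟨ (path₁ ∷ʳ l) ∷ rest , g ⟩ l∉D
  (⊆-trans (⊆-reflexive-↭ (first-path-labels σ l)) (∷⁺ʳ l (first-path∪rest⊆labels σ l)))
  (⊆-trans (∷⁺ʳ l (labels⊆first-path∪rest σ l hist l∉D avoids)) (⊆-reflexive-↭ (↭-sym (first-path-labels σ l))))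
  where open CycleSplit σ

-- The three shapes of `split D l v w`: v and w on one cycle C, whose paths P and P′ carry the
-- labels path₁ and path₂; v = w a dummy vertex, giving two new loops; and v, w in different
-- components, where the only move (d) merges them.
data SplitSpec (D : Cycles) (l : ℕ) : Split → Set where
  cycle-split : ∀ {Dbar} (σ : CycleSplit D) → let open CycleSplit σ in
                Dbar ≡ rest → SplitSpec D l (same Dbar (path₁ ∷ʳ l) (path₂ ∷ʳ l))
  dummy-split : SplitSpec D l (same D List⁺.[ l ] List⁺.[ l ])
  merge : ∀ {D′} → labels D′ ⊆ l ∷ labels D → l ∷ labels D ⊆ labels D′ → SplitSpec D l (diff D′)

value-after-move : ∀ {D g l s} γ′ hist → l ∉ labels D → SplitSpec D l s → CutterMove ⟨ D , g ⟩ s γ′ →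
  AvoidsReductions (⟨ D , g ⟩ ∷ hist) γ′ → value γ′ ≡ suc (value ⟨ D , g ⟩)
value-after-move {D} {g} {l} γ′ hist l∉D (cycle-split σ refl) (move-a _) _ = value-fresh ⟨ D , g ⟩ γ′ l∉D
  (⊆-trans (⊆-reflexive-↭ (both-paths-labels σ l)) (∈-∷⁺ʳ (here refl) ⊆-refl))
  (⊆-trans (xs⊆x∷xs _ l) (⊆-reflexive-↭ (↭-sym (both-paths-labels σ l))))
value-after-move γ′ hist l∉D (cycle-split σ refl) move-b avoids = keep-first-value σ hist l∉D avoids
value-after-move γ′ hist l∉D (cycle-split σ refl) move-c avoids =
  keep-first-value (CycleSplit.swapped σ) hist l∉D avoids
value-after-move {D} {g} {l} γ′ hist l∉D dummy-split (move-a _) _ =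
  value-fresh ⟨ D , g ⟩ γ′ l∉D (∈-∷⁺ʳ (here refl) ⊆-refl) (xs⊆x∷xs _ l)
value-after-move {D} {g} γ′ hist l∉D dummy-split move-b _ = value-fresh ⟨ D , g ⟩ γ′ l∉D ⊆-refl ⊆-refl
value-after-move {D} {g} γ′ hist l∉D dummy-split move-c _ = value-fresh ⟨ D , g ⟩ γ′ l∉D ⊆-refl ⊆-refl
value-after-move {D} {g} γ′ hist l∉D (merge D′⊆ ⊆D′) move-d _ = value-fresh ⟨ D , g ⟩ γ′ l∉D D′⊆ ⊆D′

merged-cycle : ∀ {D l} X p → X ⊆ l ∷ labels D → (∀ k → T (p k) → toList (lookup D k) ⊆ X) →
               SplitSpec D l (diff ((X ∷ʳ l) ∷ removeWhere D p))
merged-cycle {D} {l} X p X⊆ removed⊆X = merge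
  (⊆-trans (⊆-reflexive-↭ new↭) (∈-∷⁺ʳ (here refl) (++-⊆ X⊆ (there ∘ labels-removeWhere⊆ D p))))
  (⊆-trans (∷⁺ʳ l (labels⊆removeWhere D p removed⊆X)) (⊆-reflexive-↭ (↭-sym new↭)))
  where
  new↭ : labels ((X ∷ʳ l) ∷ removeWhere D p) ↭ l ∷ X ++ labels (removeWhere D p)
  new↭ = ↭.++⁺ʳ _ (toList-∷ʳ↭ X l)

T-≟∨≟ : ∀ {n} (k c c′ : Fin n) → T (⌊ k Fin.≟ c ⌋ ∨ ⌊ k Fin.≟ c′ ⌋) → k ≡ c ⊎ k ≡ c′
T-≟∨≟ k c c′ = Sum.map toWitness toWitness ∘ Equivalence.to (T-∨ {⌊ k Fin.≟ c ⌋} {⌊ k Fin.≟ c′ ⌋})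

dummy-merge : ∀ D l → SplitSpec D l (diff ((l List⁺.∷ l ∷ []) ∷ D))
dummy-merge D l = merge (∈-∷⁺ʳ (here refl) ⊆-refl) (xs⊆x∷xs _ l)

split-spec : ∀ D l v w → SplitSpec D l (split D l v w)
split-spec D l (inj₁ (c , i)) (inj₁ (c′ , j)) with c Fin.≟ c′
... | yes refl = cycle-split σ (removeWhere-≟ D c)
  where
  C = lookup D c
  n = arcLen C i j
  σ : CycleSplit D
  σ = record
    { cycle = c ; path₁ = take n (rot C i) ; path₂ = drop n (rot C i)
    ; rotation = subst (Rotation (toList C)) (sym (take++drop≡id n (rot C i))) (rot-rotation C i) }
... | no _ = merged-cycle X _ (++-⊆ (there ∘ rot⊆labels D c i) (∷⁺ʳ l (rot⊆labels D c′ j))) removed⊆X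
  where
  X = rot (lookup D c) i ++ l ∷ rot (lookup D c′) j
  removed⊆X : ∀ k → T (⌊ k Fin.≟ c ⌋ ∨ ⌊ k Fin.≟ c′ ⌋) → toList (lookup D k) ⊆ X
  removed⊆X k k-removed with T-≟∨≟ k c c′ k-removed
  ... | inj₁ refl = ⊆-trans (toList⊆rot _ i) (xs⊆xs++ys _ _)
  ... | inj₂ refl = ⊆-trans (toList⊆rot _ j) (⊆-trans (xs⊆x∷xs _ l) (xs⊆ys++xs _ (rot (lookup D c) i)))
split-spec D l (inj₁ (c , i)) (inj₂ _) = merged-cycle (rot (lookup D c) i ++ [ l ]) _
  (++-⊆ (there ∘ rot⊆labels D c i) (∈-∷⁺ʳ (here refl) λ ()))
  λ k k≡c → case toWitness {a? = k Fin.≟ c} k≡c of λ { refl → ⊆-trans (toList⊆rot _ i) (xs⊆xs++ys _ _) }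
split-spec D l (inj₂ _) (inj₁ (c′ , j)) = merged-cycle (l ∷ rot (lookup D c′) j) _
  (∷⁺ʳ l (rot⊆labels D c′ j))
  λ k k≡c′ → case toWitness {a? = k Fin.≟ c′} k≡c′ of λ { refl → ⊆-trans (toList⊆rot _ j) (xs⊆x∷xs _ l) }
split-spec D l (inj₂ vγ) (inj₂ vγ) = dummy-split
split-spec D l (inj₂ wγ) (inj₂ wγ) = dummy-split
split-spec D l (inj₂ vγ) (inj₂ wγ) = dummy-merge D l
split-spec D l (inj₂ wγ) (inj₂ vγ) = dummy-merge D l

corollary4p9 : (γ : State) → ProperState γ → (hist : List State) →
    (v w : MVtx (D γ)) → (l : ℕ) → l ∉ labels (D γ) →
    (γ' : State) → RestrictedMove hist γ v w l γ' →
    value γ' ≡ suc (value γ)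
corollary4p9 ⟨ D , g ⟩ _ hist v w l l∉D γ′ (move , avoids) =
  value-after-move γ′ hist l∉D (split-spec D l v w) move avoids
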